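{- Suppose the Ramsey number $R_{\mathbb{G}}(\mathbb{X},\mathcal{C})$ (maximal base $\mathbb{G}=\{G_i\}_{i\in I}$) exists and is of Galois type with $q$ colors. Treat $p[G_i,\mathbb{X},\mathcal{C}]$ as an element of the ring $\mathcal{P}(\mathbb{F}_q^{(E(G_i))},\mathbb{F}_q)$ of polynomial functions, and write $i_m=\max\{i\in I: p[G_i,\mathbb{X},\mathcal{C}]\neq 0\}$ and $i_k=\min\{i\in I: p[G_i,\mathbb{X},\mathcal{C}]=0\}$. Then $i_{m+1}=R_{\mathbb{G}}(\mathbb{X},\mathcal{C})=i_k$, where $i_{m+1}$ denotes the successor of $i_m$ in $I$.
   Context: All graphs are finite and undirected; $\mathrm{Hom}(G,A)$ is the set of maps $E(G)\to A$. The isomorphism set $G/X$ is the set of edge maps $\pi:E(Y)\to E(X)$ induced by graph isomorphisms $V(Y)\to V(X)$, $Y$ ranging over subgraphs of $G$; $\pi^{ -1}(X)$ denotes $E(Y)$, and "$\rho|_{\pi^{ -1}(X)}=\psi\circ\pi$" means $\rho(e)=\psi(\pi(e))$ for all $e\in E(Y)$. $I$ is a strictly well-ordered index set. $\mathbb{G}=\{G_i\}_{i\in I}$ is hereditary: for all $0<i\le k$ in $I$ ($0$ the least element), every $G_s$ with $s<i$ satisfies $G_t/G_s\neq\emptyset$ for all $t\ge k$. Galois type with maximal base: there is a color set $A$ with $|A|=q$ a prime power, identified with $\mathbb{F}_q$; the admissible colorings at index $i$ are all of $\mathrm{Hom}(G_i,\mathbb{F}_q)$; the symbol is uniform and of finite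 type: a fixed finite family $\mathbb{X}=\{X_j\}_{j\in J}$ with colorings $\mathcal{C}=\{\psi_j\}_{j\in J}$, $\psi_j\in\mathrm{Hom}(X_j,\mathbb{F}_q)$, used at every index. $R_{\mathbb{G}}(\mathbb{X},\mathcal{C})$ is the least $n\in I$ (if any) such that for all $t\ge n$ and all $\rho\in\mathrm{Hom}(G_t,\mathbb{F}_q)$ there exist $j\in J$, $\pi\in G_t/X_j$ with $\rho|_{\pi^{ -1}(X_j)}=\psi_j\circ\pi$. Colorings $\rho\in\mathrm{Hom}(G,\mathbb{F}_q)$ are identified with points of $\mathbb{F}_q^{(E(G))}$. $p[G,X,\psi](x)=\prod_{\pi\in G/X}\big(1-\prod_{e\in\pi^{ -1}(X)}(1-(x_e-\psi(\pi(e)))^{q-1})\big)$ and $p[G,\mathbb{X},\mathcal{C}]=\prod_{j\in J}p[G,X_j,\psi_j]$. -}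

module Defs where

open import Level using (0ℓ)
open import Data.Nat as ℕ using (ℕ; zero; suc)
open import Data.Nat.Primality using (Prime)
open import Data.Fin as Fin using (Fin; zero; suc)
open import Data.Fin.Properties using (all?; <-cmp) renaming (_≟_ to _≟ᶠ_)
open import Data.Bool using (Bool; true; false)
open import Data.Bool.Properties using () renaming (_≟_ to _≟ᵇ_)
open import Data.Product using (Σ; ∃; ∃-syntax; _×_; _,_; proj₁; proj₂)
import Data.Product.Properties as ×P
open import Data.Sum using (_⊎_)
open import Data.List using (List; []; _∷_; map; concatMap; foldr; deduplicate)
import Data.List.Properties as LP
open import Data.List.Membership.Propositional using (_∈_)
open import Data.List.Relation.Unary.All using (All)
open import Data.Empty using (⊥; ⊥-elim)
open import Relation.Nullary using (¬_; Dec; yes; no)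
open import Relation.Nullary.Decidable using (_→-dec_; _×-dec_)
open import Relation.Binary using (Rel; Tri; tri<; tri≈; tri>)
open import Relation.Binary.PropositionalEquality using (_≡_; _≢_; refl; sym; trans; cong)
open import Algebra.Structures using (IsCommutativeRing)

record Graph : Set where
  field
    nV     : ℕ
    adj    : Fin nV → Fin nV → Bool
    adj-sym    : ∀ u v → adj u v ≡ adj v u
    adj-irrefl : ∀ v → adj v v ≡ false
open Graph public

-- An (undirected) edge {u,v} is represented canonically by (u , v) with u < v.
Edge : Graph → Set
Edge G = Σ (Fin (nV G) × Fin (nV G)) λ uv →
           (proj₁ uv Fin.< proj₂ uv) × (adj G (proj₁ uv) (proj₂ uv) ≡ true)

Hom : Graph → Set → Set
Hom G A = Edge G → A

edgesFrom : ∀ {n} (a : Fin n → Fin n → Bool) (u : Fin n) → List (Fin n) →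
            List (Σ (Fin n × Fin n) λ uv → (proj₁ uv Fin.< proj₂ uv) × (a (proj₁ uv) (proj₂ uv) ≡ true))
edgesFrom a u [] = []
edgesFrom a u (v ∷ vs) with u Fin.<? v | a u v ≟ᵇ true
... | yes u<v | yes e = ((u , v) , u<v , e) ∷ edgesFrom a u vs
... | _       | _     = edgesFrom a u vs

edges : (G : Graph) → List (Edge G)
edges G = concatMap (λ u → edgesFrom (adj G) u (Data.List.allFin (nV G))) (Data.List.allFin (nV G))

-- A pair (Y, φ) with Y ⊆ G a subgraph and φ : V(Y) → V(X) a graph
-- isomorphism corresponds exactly to the injective map f = φ⁻¹ : V(X) → V(G)
-- sending edges of X to edges of G (then V(Y) = im f, E(Y) = f(E(X))).

Injective : ∀ {a b} → (Fin a → Fin b) → Set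
Injective f = ∀ u v → f u ≡ f v → u ≡ v

EdgePreserving : (X G : Graph) → (Fin (nV X) → Fin (nV G)) → Set
EdgePreserving X G f = ∀ u v → adj X u v ≡ true → adj G (f u) (f v) ≡ true

Embedding : Graph → Graph → Set
Embedding X G = Σ (Fin (nV X) → Fin (nV G)) λ f → Injective f × EdgePreserving X G f

allFuns : (a b : ℕ) → List (Fin a → Fin b)
allFuns zero    b = (λ ()) ∷ []
allFuns (suc a) b = concatMap (λ f → map (λ y → λ { zero → y ; (suc i) → f i }) (Data.List.allFin b)) (allFuns a b)

filterΣ : ∀ {A : Set} (P : A → Set) → (∀ x → Dec (P x)) → List A → List (Σ A P)
filterΣ P P? [] = []
filterΣ P P? (x ∷ xs) with P? x
... | yes p = (x , p) ∷ filterΣ P P? xs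
... | no _  = filterΣ P P? xs

embeddings : (X G : Graph) → List (Embedding X G)
embeddings X G = filterΣ _ dec (allFuns (nV X) (nV G))
  where
  dec : ∀ f → Dec (Injective f × EdgePreserving X G f)
  dec f = all? (λ u → all? (λ v → (f u ≟ᶠ f v) →-dec (u ≟ᶠ v)))
          ×-dec all? (λ u → all? (λ v → (adj X u v ≟ᵇ true) →-dec (adj G (f u) (f v) ≟ᵇ true)))

edgeImage : ∀ X G → Embedding X G → Edge X → Edge G
edgeImage X G (f , inj , pres) ((u , v) , u<v , e) with <-cmp (f u) (f v)
... | tri< lt _ _ = ((f u , f v) , lt , pres u v e)
... | tri≈ _ eq _ = ⊥-elim (Data.Fin.Properties.<-irrefl (inj u v eq) u<v)
... | tri> _ _ gt = ((f v , f u) , gt , trans (adj-sym G (f v) (f u)) (pres u v e))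

-- An edge map π : E(Y) → E(X) is represented by its graph:
-- the list of pairs (e , π e) for e ∈ E(Y) = π⁻¹(X).
EdgeMap : Graph → Graph → Set
EdgeMap G X = List (Edge G × Edge X)

edgeMapOf : ∀ X G → Embedding X G → EdgeMap G X
edgeMapOf X G φ = map (λ e → (edgeImage X G φ e , e)) (edges X)

-- underlying G-vertex pairs; two edge maps (listed along edges X) are equal
-- iff these coincide
keyOf : ∀ {G X} → EdgeMap G X → List (Fin (nV G) × Fin (nV G))
keyOf = map (λ p → proj₁ (proj₁ p))

isoSet : (G X : Graph) → List (EdgeMap G X)
isoSet G X = deduplicate (λ π π′ → LP.≡-dec (×P.≡-dec _≟ᶠ_ _≟ᶠ_) (keyOf {G} {X} π) (keyOf {G} {X} π′))
                         (map (edgeMapOf X G) (embeddings X G))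

-- Finite field structure on Fin q (colors A = Fin q identified with 𝔽_q).

IsPrimePower : ℕ → Set
IsPrimePower q = ∃[ p ] ∃[ k ] Prime p × q ≡ p ℕ.^ suc k

record FieldOn (q : ℕ) : Set where
  field
    _+_ _*_ : Fin q → Fin q → Fin q
    -_      : Fin q → Fin q
    0# 1#   : Fin q
    isCommutativeRing : IsCommutativeRing _≡_ _+_ _*_ -_ 0# 1#
    0≢1     : 0# ≢ 1#
    inverse : ∀ x → x ≢ 0# → ∃[ y ] x * y ≡ 1#

module Poly {q : ℕ} (F : FieldOn q) where
  open FieldOn F

  _-_ : Fin q → Fin q → Fin q
  a - b = a + (- b)

  _^_ : Fin q → ℕ → Fin q
  a ^ zero  = 1#
  a ^ suc n = a * (a ^ n)

  prod : List (Fin q) → Fin q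
  prod = foldr _*_ 1#

  p1 : (G X : Graph) → Hom X (Fin q) → (Edge G → Fin q) → Fin q
  p1 G X ψ x = prod (map (λ π → 1# - prod (map (λ ee → 1# - ((x (proj₁ ee) - ψ (proj₂ ee)) ^ (q ℕ.∸ 1))) π))
                         (isoSet G X))

  pFam : (G : Graph) {nJ : ℕ} (X : Fin nJ → Graph) (ψ : (j : Fin nJ) → Hom (X j) (Fin q)) →
         (Edge G → Fin q) → Fin q
  pFam G X ψ x = prod (map (λ j → p1 G (X j) (ψ j) x) (Data.List.allFin _))

  IsZeroFun : (G : Graph) → ((Edge G → Fin q) → Fin q) → Set
  IsZeroFun G f = ∀ x → f x ≡ 0#

module OrderNotions {I : Set} (_<_ : Rel I 0ℓ) where
  _≤_ : Rel I 0ℓ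
  i ≤ j = i < j ⊎ i ≡ j

  IsLeast : (I → Set) → I → Set
  IsLeast P n = P n × (∀ i → P i → n ≤ i)

  IsGreatest : (I → Set) → I → Set
  IsGreatest P m = P m × (∀ i → P i → i ≤ m)

  IsSuccessor : I → I → Set
  IsSuccessor m n = m < n × (∀ i → m < i → n ≤ i)

  -- hereditary family: for 0 < i ≤ k, s < i, t ≥ k we have G_t/G_s ≠ ∅
  -- (0 < i is implied by the existence of s < i)
  Hereditary : (I → Graph) → Set
  Hereditary G = ∀ i k → i ≤ k → ∀ s → s < i → ∀ t → k ≤ t → isoSet (G t) (G s) ≢ []

  -- the Ramsey property at n, for all colorings (maximal base), uniform symbol
  RamseyProp : {q : ℕ} (G : I → Graph) {nJ : ℕ} (X : Fin nJ → Graph)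
               (ψ : (j : Fin nJ) → Hom (X j) (Fin q)) → I → Set
  RamseyProp {q} G X ψ n =
    ∀ t → n ≤ t → (ρ : Hom (G t) (Fin q)) →
    ∃[ j ] ∃[ π ] (π ∈ isoSet (G t) (X j)) × All (λ ee → ρ (proj₁ ee) ≡ ψ j (proj₂ ee)) π

  IsRamseyNumber : {q : ℕ} (G : I → Graph) {nJ : ℕ} (X : Fin nJ → Graph)
                   (ψ : (j : Fin nJ) → Hom (X j) (Fin q)) → I → Set
  IsRamseyNumber G X ψ = IsLeast (RamseyProp G X ψ)

-- By Fermat's little theorem, (a − b)^(q−1) is 0 when a = b and 1 otherwise, so the factor
-- 1 − ∏_e (1 − (x_e − ψ(π e))^(q−1)) of p[G,X,ψ] vanishes at a coloring x exactly when x
-- agrees with ψ ∘ π on π⁻¹(X).  Hence p[G_i,𝕏,𝒞] = 0 iff every coloring of G_i contains a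
-- ψ_j-colored copy of some X_j.  Pulling colorings back along the embeddings G_s → G_t
-- (s < t) given by heredity shows that this property is upward closed, so the indices where
-- p vanishes form an upper set: its least element is the Ramsey number, which is then also
-- the successor of the last index where p does not vanish.

module Submission where

open import Defs
open import Level using (0ℓ)
open import Data.Nat using (ℕ; zero; suc)
open import Data.Fin using (Fin; zero; suc; punchIn)
open import Data.Fin.Properties using (¬Fin0; punchInᵢ≢i; <-cmp; <-irrefl; <-asym; <-irrelevant) renaming (_≟_ to _≟ᶠ_)
open import Data.Fin.Permutation using (permutation)
open import Data.Vec.Functional using (Vector; removeAt; replicate)
import Data.Bool.Properties as Bool
open import Data.Bool using (true)
open import Data.Product using (∃-syntax; _×_; _,_; proj₁; proj₂; uncurry)
import Data.Product as Product
open import Data.Sum using (inj₁; inj₂)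
open import Data.Empty using (⊥-elim)
open import Data.List using (List; []; _∷_; map; allFin)
import Data.List.Properties as List
open import Data.List.Membership.Propositional using (_∈_; find)
open import Data.List.Membership.Propositional.Properties using (∈-allFin; ∈-map⁺; ∈-map⁻; ∈-concat⁺′; ∈-deduplicate⁻)
open import Data.List.Relation.Unary.Any using (here; there)
import Data.List.Relation.Unary.Any as Any
import Data.List.Relation.Unary.Any.Properties as Any
open import Data.List.Relation.Unary.All as All using (All; []; _∷_)
import Data.List.Relation.Unary.All.Properties as All
open import Function using (_∘_; id)
open import Function.Bundles using (_⇔_; mk⇔; Equivalence)
import Function.Properties.Equivalence as ⇔
open import Relation.Nullary using (¬_; Dec; yes; no)
open import Relation.Binary using (Rel; IsStrictTotalOrder; _Respects_; tri<; tri≈; tri>)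
open import Relation.Binary.PropositionalEquality
open import Axiom.UniquenessOfIdentityProofs using (module Decidable⇒UIP)
open import Algebra.Bundles using (CommutativeRing)
import Algebra.Properties.Ring as RingProperties
import Algebra.Properties.CommutativeMonoid.Sum as ProductProperties
open import Induction.WellFounded using (WellFounded)

Agrees : ∀ {E E′ A : Set} → (E → A) → (E′ → A) → List (E × E′) → Set
Agrees ρ ψ π = All (λ ee → ρ (proj₁ ee) ≡ ψ (proj₂ ee)) π

HasColoredCopy : ∀ {q} (H : Graph) {nJ} (X : Fin nJ → Graph) (ψ : ∀ j → Hom (X j) (Fin q)) →
                 Hom H (Fin q) → Set
HasColoredCopy H X ψ ρ = ∃[ j ] ∃[ π ] π ∈ isoSet H (X j) × Agrees ρ (ψ j) π

Arrows : ∀ {q} (H : Graph) {nJ} (X : Fin nJ → Graph) (ψ : ∀ j → Hom (X j) (Fin q)) → Set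
Arrows H X ψ = ∀ ρ → HasColoredCopy H X ψ ρ

module FiniteField {k : ℕ} (F : FieldOn (suc (suc k))) where
  open FieldOn F
  open Poly F

  𝔽 : Set
  𝔽 = Fin (suc (suc k))

  commutativeRing : CommutativeRing 0ℓ 0ℓ
  commutativeRing = record
    { Carrier = 𝔽 ; _≈_ = _≡_ ; _+_ = _+_ ; _*_ = _*_ ; -_ = -_
    ; 0# = 0# ; 1# = 1# ; isCommutativeRing = isCommutativeRing }

  open CommutativeRing commutativeRing
    using (+-identityʳ; -‿inverseʳ; *-identityˡ; *-identityʳ; *-assoc; *-comm; zeroˡ; zeroʳ; *-commutativeMonoid)
  open RingProperties (CommutativeRing.ring commutativeRing) using (x∙y⁻¹≈ε⇒x≈y; -0#≈0#)
  module Π = ProductProperties *-commutativeMonoid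

  x-y≡0⇒x≡y : ∀ {x y} → x - y ≡ 0# → x ≡ y
  x-y≡0⇒x≡y = x∙y⁻¹≈ε⇒x≈y _ _

  x-0≡x : ∀ x → x - 0# ≡ x
  x-0≡x x = trans (cong (x +_) -0#≈0#) (+-identityʳ x)

  *-nonzero : ∀ {x y} → x ≢ 0# → y ≢ 0# → x * y ≢ 0#
  *-nonzero {x} {y} x≢0 y≢0 xy≡0 with inverse x x≢0
  ... | x⁻¹ , xx⁻¹≡1 = y≢0 (begin
    y                 ≡⟨ *-identityˡ y ⟨
    1# * y            ≡⟨ cong (_* y) (trans (*-comm x⁻¹ x) xx⁻¹≡1) ⟨
    (x⁻¹ * x) * y     ≡⟨ *-assoc x⁻¹ x y ⟩
    x⁻¹ * (x * y)     ≡⟨ cong (x⁻¹ *_) xy≡0 ⟩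
    x⁻¹ * 0#          ≡⟨ zeroʳ x⁻¹ ⟩
    0#                ∎)
    where open ≡-Reasoning

  x*y≡y⇒x≡1 : ∀ {x y} → y ≢ 0# → x * y ≡ y → x ≡ 1#
  x*y≡y⇒x≡1 {x} {y} y≢0 xy≡y with inverse y y≢0
  ... | y⁻¹ , yy⁻¹≡1 = begin
    x                 ≡⟨ *-identityʳ x ⟨
    x * 1#            ≡⟨ cong (x *_) yy⁻¹≡1 ⟨
    x * (y * y⁻¹)     ≡⟨ *-assoc x y y⁻¹ ⟨
    (x * y) * y⁻¹     ≡⟨ cong (_* y⁻¹) xy≡y ⟩
    y * y⁻¹           ≡⟨ yy⁻¹≡1 ⟩
    1#                ∎
    where open ≡-Reasoning

  ∏-nonzero : ∀ {m} (f : Vector 𝔽 m) → (∀ i → f i ≢ 0#) → Π.sum f ≢ 0#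
  ∏-nonzero {zero}  f f≢0 1≡0 = 0≢1 (sym 1≡0)
  ∏-nonzero {suc m} f f≢0 = *-nonzero (f≢0 zero) (∏-nonzero (λ i → f (suc i)) (λ i → f≢0 (suc i)))

  ∏-replicate : ∀ m x → Π.sum (replicate m x) ≡ x ^ m
  ∏-replicate zero    x = refl
  ∏-replicate (suc m) x = cong (x *_) (∏-replicate m x)

  -- Multiplying by x permutes the field, and the product of all elements,
  -- with 0 replaced by 1, absorbs one factor x for each of the q − 1 nonzero ones.
  fermat : ∀ x → x ≢ 0# → x ^ suc k ≡ 1#
  fermat x x≢0 with inverse x x≢0
  ... | x⁻¹ , xx⁻¹≡1 = x*y≡y⇒x≡1 (∏-nonzero unit unit≢0) (begin
    (x ^ suc k) * Π.sum unit                   ≡⟨ cong (_* Π.sum unit) ∏scale≡x^[q-1] ⟨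
    Π.sum scale * Π.sum unit                   ≡⟨ Π.∑-distrib-+ scale unit ⟨
    Π.sum (λ z → scale z * unit z)            ≡⟨ Π.sum-cong-≗ unit-x* ⟨
    Π.sum (λ z → unit (x * z))                ≡⟨ Π.sum-permute unit (permutation (x *_) (x⁻¹ *_) x*x⁻¹* x⁻¹*x*) ⟨
    Π.sum unit                                 ∎)
    where
    open ≡-Reasoning
    unit : 𝔽 → 𝔽
    unit z with z ≟ᶠ 0#
    ... | yes _ = 1#
    ... | no _  = z
    unit≢0 : ∀ z → unit z ≢ 0#
    unit≢0 z with z ≟ᶠ 0#
    ... | yes _   = λ 1≡0 → 0≢1 (sym 1≡0)
    ... | no z≢0  = z≢0
    scale : 𝔽 → 𝔽
    scale z with z ≟ᶠ 0#
    ... | yes _ = 1#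
    ... | no _  = x
    x*x⁻¹* : ∀ z → x * (x⁻¹ * z) ≡ z
    x*x⁻¹* z = trans (sym (*-assoc x x⁻¹ z)) (trans (cong (_* z) xx⁻¹≡1) (*-identityˡ z))
    x⁻¹*x* : ∀ z → x⁻¹ * (x * z) ≡ z
    x⁻¹*x* z = trans (sym (*-assoc x⁻¹ x z)) (trans (cong (_* z) (trans (*-comm x⁻¹ x) xx⁻¹≡1)) (*-identityˡ z))
    unit-x* : ∀ z → unit (x * z) ≡ scale z * unit z
    unit-x* z with z ≟ᶠ 0# | x * z ≟ᶠ 0#
    ... | yes _   | yes _    = sym (*-identityˡ 1#)
    ... | yes z≡0 | no xz≢0  = ⊥-elim (xz≢0 (trans (cong (x *_) z≡0) (zeroʳ x)))
    ... | no z≢0  | yes xz≡0 = ⊥-elim (z≢0 (trans (sym (x⁻¹*x* z)) (trans (cong (x⁻¹ *_) xz≡0) (zeroʳ x⁻¹))))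
    ... | no _    | no _     = refl
    scale-punchIn : removeAt scale 0# ≗ replicate (suc k) x
    scale-punchIn i with punchIn 0# i ≟ᶠ 0#
    ... | yes p = ⊥-elim (punchInᵢ≢i 0# i p)
    ... | no _  = refl
    scale0 : scale 0# ≡ 1#
    scale0 with 0# ≟ᶠ 0#
    ... | yes _  = refl
    ... | no 0≢0 = ⊥-elim (0≢0 refl)
    ∏scale≡x^[q-1] : Π.sum scale ≡ x ^ suc k
    ∏scale≡x^[q-1] = begin
      Π.sum scale                                 ≡⟨ Π.sum-remove {i = 0#} scale ⟩
      scale 0# * Π.sum (removeAt scale 0#)        ≡⟨ cong₂ _*_ scale0 (Π.sum-cong-≗ scale-punchIn) ⟩
      1# * Π.sum (replicate (suc k) x)            ≡⟨ *-identityˡ _ ⟩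
      Π.sum (replicate (suc k) x)                 ≡⟨ ∏-replicate (suc k) x ⟩
      x ^ suc k                                   ∎

  prod-≡0⁺ : ∀ {A : Set} (f : A → 𝔽) {xs a} → a ∈ xs → f a ≡ 0# → prod (map f xs) ≡ 0#
  prod-≡0⁺ f {x ∷ xs} (here refl) fa≡0 = trans (cong (_* prod (map f xs)) fa≡0) (zeroˡ _)
  prod-≡0⁺ f {x ∷ xs} (there a∈) fa≡0 = trans (cong (f x *_) (prod-≡0⁺ f a∈ fa≡0)) (zeroʳ _)

  prod-≡0⁻ : ∀ {A : Set} (f : A → 𝔽) xs → prod (map f xs) ≡ 0# → ∃[ a ] a ∈ xs × f a ≡ 0#
  prod-≡0⁻ f []       1≡0 = ⊥-elim (0≢1 (sym 1≡0))
  prod-≡0⁻ f (x ∷ xs) p≡0 with f x ≟ᶠ 0#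
  ... | yes fx≡0 = x , here refl , fx≡0
  ... | no fx≢0 with prod (map f xs) ≟ᶠ 0#
  ...   | yes ps≡0 = let a , a∈ , fa≡0 = prod-≡0⁻ f xs ps≡0 in a , there a∈ , fa≡0
  ...   | no ps≢0  = ⊥-elim (*-nonzero fx≢0 ps≢0 p≡0)

  prod-≡1 : ∀ {A : Set} (f : A → 𝔽) {xs} → All (λ a → f a ≡ 1#) xs → prod (map f xs) ≡ 1#
  prod-≡1 f []           = refl
  prod-≡1 f (fx≡1 ∷ fxs≡1) = trans (cong₂ _*_ fx≡1 (prod-≡1 f fxs≡1)) (*-identityˡ 1#)

  prod-≡1⇒nonzero : ∀ {A : Set} (f : A → 𝔽) {xs} → prod (map f xs) ≡ 1# → All (λ a → f a ≢ 0#) xs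
  prod-≡1⇒nonzero f p≡1 = All.tabulate (λ a∈ fa≡0 → 0≢1 (trans (sym (prod-≡0⁺ f a∈ fa≡0)) p≡1))

  agreement : 𝔽 → 𝔽 → 𝔽
  agreement x y = 1# - ((x - y) ^ suc k)

  agreement-≡ : ∀ x → agreement x x ≡ 1#
  agreement-≡ x = begin
    1# - ((x - x) ^ suc k)   ≡⟨ cong (λ z → 1# - (z ^ suc k)) (-‿inverseʳ x) ⟩
    1# - (0# ^ suc k)        ≡⟨ cong (λ z → 1# - z) (zeroˡ _) ⟩
    1# - 0#                  ≡⟨ x-0≡x 1# ⟩
    1#                       ∎
    where open ≡-Reasoning

  agreement-≢ : ∀ {x y} → x ≢ y → agreement x y ≡ 0#
  agreement-≢ {x} {y} x≢y = begin
    1# - ((x - y) ^ suc k)   ≡⟨ cong (λ z → 1# - z) (fermat (x - y) (x≢y ∘ x-y≡0⇒x≡y)) ⟩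
    1# - 1#                  ≡⟨ -‿inverseʳ 1# ⟩
    0#                       ∎
    where open ≡-Reasoning

  agreement≢0⇒≡ : ∀ {x y} → agreement x y ≢ 0# → x ≡ y
  agreement≢0⇒≡ {x} {y} a≢0 with x ≟ᶠ y
  ... | yes x≡y = x≡y
  ... | no x≢y  = ⊥-elim (a≢0 (agreement-≢ x≢y))

  -- p1 G X ψ x unfolds to the product of copyFactor x ψ π over π ∈ isoSet G X.
  copyFactor : ∀ {E E′ : Set} → (E → 𝔽) → (E′ → 𝔽) → List (E × E′) → 𝔽
  copyFactor x ψ π = 1# - prod (map (λ ee → agreement (x (proj₁ ee)) (ψ (proj₂ ee))) π)

  agrees⇒copyFactor≡0 : ∀ {E E′ : Set} {x : E → 𝔽} {ψ : E′ → 𝔽} {π} → Agrees x ψ π → copyFactor x ψ π ≡ 0#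
  agrees⇒copyFactor≡0 {x = x} {ψ} agrees =
    trans (cong (λ z → 1# - z) (prod-≡1 _ (All.map agree⇒1 agrees))) (-‿inverseʳ 1#)
    where
    agree⇒1 : ∀ {ee} → x (proj₁ ee) ≡ ψ (proj₂ ee) → agreement (x (proj₁ ee)) (ψ (proj₂ ee)) ≡ 1#
    agree⇒1 {ee} eq = trans (cong (λ z → agreement z (ψ (proj₂ ee))) eq) (agreement-≡ _)

  copyFactor≡0⇒agrees : ∀ {E E′ : Set} {x : E → 𝔽} {ψ : E′ → 𝔽} {π} → copyFactor x ψ π ≡ 0# → Agrees x ψ π
  copyFactor≡0⇒agrees c≡0 = All.map agreement≢0⇒≡ (prod-≡1⇒nonzero _ (sym (x-y≡0⇒x≡y c≡0)))

  module _ (H : Graph) {nJ} (X : Fin nJ → Graph) (ψ : ∀ j → Hom (X j) 𝔽) where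

    hasColoredCopy⇒pFam≡0 : ∀ {x} → HasColoredCopy H X ψ x → pFam H X ψ x ≡ 0#
    hasColoredCopy⇒pFam≡0 {x} (j , π , π∈ , agrees) =
      prod-≡0⁺ (λ j → p1 H (X j) (ψ j) x) (∈-allFin j) (prod-≡0⁺ (copyFactor x (ψ j)) π∈ (agrees⇒copyFactor≡0 agrees))

    pFam≡0⇒hasColoredCopy : ∀ {x} → pFam H X ψ x ≡ 0# → HasColoredCopy H X ψ x
    pFam≡0⇒hasColoredCopy {x} p≡0 with prod-≡0⁻ (λ j → p1 H (X j) (ψ j) x) (allFin nJ) p≡0
    ... | j , _ , p1≡0 with prod-≡0⁻ (copyFactor x (ψ j)) (isoSet H (X j)) p1≡0
    ... | π , π∈ , c≡0 = j , π , π∈ , copyFactor≡0⇒agrees c≡0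

    isZeroFun⇔arrows : IsZeroFun H (pFam H X ψ) ⇔ Arrows H X ψ
    isZeroFun⇔arrows = mk⇔ (λ z x → pFam≡0⇒hasColoredCopy (z x)) (λ a x → hasColoredCopy⇒pFam≡0 (a x))

Edge-≡ : ∀ {G} {e e′ : Edge G} → proj₁ e ≡ proj₁ e′ → e ≡ e′
Edge-≡ {e = uv , u<v , adj} {.uv , u<v′ , adj′} refl =
  cong₂ (λ p q → uv , p , q) (<-irrelevant u<v u<v′) (Decidable⇒UIP.≡-irrelevant Bool._≟_ adj adj′)

sortPair : ∀ {n} → Fin n → Fin n → Fin n × Fin n
sortPair a b with <-cmp a b
... | tri< _ _ _ = a , b
... | tri≈ _ _ _ = a , b
... | tri> _ _ _ = b , a

sortPair-comm : ∀ {n} {a b : Fin n} → a ≢ b → sortPair a b ≡ sortPair b a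
sortPair-comm {a = a} {b} a≢b with <-cmp a b | <-cmp b a
... | tri< _ _ _   | tri> _ _ _   = refl
... | tri> _ _ _   | tri< _ _ _   = refl
... | tri< a<b _ _ | tri< b<a _ _ = ⊥-elim (<-asym a<b b<a)
... | tri> _ _ b<a | tri> _ _ a<b = ⊥-elim (<-asym a<b b<a)
... | tri≈ _ a≡b _ | _            = ⊥-elim (a≢b a≡b)
... | _            | tri≈ _ b≡a _ = ⊥-elim (a≢b (sym b≡a))

sortPair-map : ∀ {n m} {g : Fin n → Fin m} → Injective g → {a b : Fin n} → a ≢ b →
               uncurry sortPair (Product.map g g (sortPair a b)) ≡ sortPair (g a) (g b)
sortPair-map {g = g} g-inj {a} {b} a≢b with <-cmp a b
... | tri< _ _ _   = refl
... | tri≈ _ a≡b _ = ⊥-elim (a≢b a≡b)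
... | tri> _ _ _   = sortPair-comm (a≢b ∘ sym ∘ g-inj b a)

edgeImage-sortPair : ∀ X G (φ : Embedding X G) (e : Edge X) →
  proj₁ (edgeImage X G φ e) ≡ uncurry sortPair (Product.map (proj₁ φ) (proj₁ φ) (proj₁ e))
edgeImage-sortPair X G (f , f-inj , _) ((u , v) , u<v , _) with <-cmp (f u) (f v)
... | tri< _ _ _     = refl
... | tri≈ _ fu≡fv _ = ⊥-elim (<-irrefl (f-inj u v fu≡fv) u<v)
... | tri> _ _ _     = refl

edgeImage-cong : ∀ X G (φ φ′ : Embedding X G) → proj₁ φ ≗ proj₁ φ′ → edgeImage X G φ ≗ edgeImage X G φ′
edgeImage-cong X G φ φ′ f≗f′ e@((u , v) , _) = Edge-≡ {G} (begin
  proj₁ (edgeImage X G φ e)             ≡⟨ edgeImage-sortPair X G φ e ⟩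
  sortPair (proj₁ φ u) (proj₁ φ v)      ≡⟨ cong₂ sortPair (f≗f′ u) (f≗f′ v) ⟩
  sortPair (proj₁ φ′ u) (proj₁ φ′ v)    ≡⟨ edgeImage-sortPair X G φ′ e ⟨
  proj₁ (edgeImage X G φ′ e)            ∎)
  where open ≡-Reasoning

composeEmbedding : ∀ X S T → Embedding S T → Embedding X S → Embedding X T
composeEmbedding X S T (g , g-inj , g-pres) (f , f-inj , f-pres) =
  g ∘ f , (λ u v → f-inj u v ∘ g-inj (f u) (f v)) , (λ u v → g-pres (f u) (f v) ∘ f-pres u v)

edgeImage-compose : ∀ X S T (g : Embedding S T) (φ : Embedding X S) (e : Edge X) →
  edgeImage X T (composeEmbedding X S T g φ) e ≡ edgeImage S T g (edgeImage X S φ e)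
edgeImage-compose X S T g φ e@((u , v) , u<v , _) = Edge-≡ {T} (begin
  proj₁ (edgeImage X T (composeEmbedding X S T g φ) e)
    ≡⟨ edgeImage-sortPair X T (composeEmbedding X S T g φ) e ⟩
  sortPair (h (f u)) (h (f v))
    ≡⟨ sortPair-map (proj₁ (proj₂ g)) fu≢fv ⟨
  uncurry sortPair (Product.map h h (sortPair (f u) (f v)))
    ≡⟨ cong (uncurry sortPair ∘ Product.map h h) (edgeImage-sortPair X S φ e) ⟨
  uncurry sortPair (Product.map h h (proj₁ (edgeImage X S φ e)))
    ≡⟨ edgeImage-sortPair S T g (edgeImage X S φ e) ⟨
  proj₁ (edgeImage S T g (edgeImage X S φ e))
    ∎)
  where
  open ≡-Reasoning
  f = proj₁ φ
  h = proj₁ g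
  fu≢fv : f u ≢ f v
  fu≢fv fu≡fv = <-irrefl (proj₁ (proj₂ φ) u v fu≡fv) u<v

edgeMapOf-cong : ∀ X G (φ φ′ : Embedding X G) → proj₁ φ ≗ proj₁ φ′ → edgeMapOf X G φ ≡ edgeMapOf X G φ′
edgeMapOf-cong X G φ φ′ f≗f′ = List.map-cong (λ e → cong (_, e) (edgeImage-cong X G φ φ′ f≗f′ e)) (edges X)

edgeMapOf-keyOf-injective : ∀ X G (φ φ′ : Embedding X G) →
  keyOf {G} {X} (edgeMapOf X G φ) ≡ keyOf {G} {X} (edgeMapOf X G φ′) → edgeMapOf X G φ ≡ edgeMapOf X G φ′
edgeMapOf-keyOf-injective X G φ φ′ = go (edges X)
  where
  go : ∀ es → keyOf {G} {X} (map (λ e → edgeImage X G φ e , e) es) ≡ keyOf {G} {X} (map (λ e → edgeImage X G φ′ e , e) es) →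
       map (λ e → edgeImage X G φ e , e) es ≡ map (λ e → edgeImage X G φ′ e , e) es
  go []       _  = refl
  go (e ∷ es) eq = cong₂ _∷_ (cong (_, e) (Edge-≡ {G} (List.∷-injectiveˡ eq))) (go es (List.∷-injectiveʳ eq))

allFuns-complete : ∀ a b (f : Fin a → Fin b) → ∃[ f′ ] f′ ∈ allFuns a b × f′ ≗ f
allFuns-complete zero    b f = _ , here refl , λ ()
allFuns-complete (suc a) b f with allFuns-complete a b (f ∘ suc)
... | f′ , f′∈ , f′≗f = _ , ∈-concat⁺′ (∈-map⁺ _ (∈-allFin (f zero))) (∈-map⁺ _ f′∈) , λ { zero → refl ; (suc i) → f′≗f i }

filterΣ-complete : ∀ {A : Set} {P : A → Set} (P? : ∀ x → Dec (P x)) {xs x} → x ∈ xs → P x →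
                   ∃[ p ] (x , p) ∈ filterΣ P P? xs
filterΣ-complete P? {y ∷ xs} (here refl) px with P? y
... | yes p  = p , here refl
... | no ¬px = ⊥-elim (¬px px)
filterΣ-complete P? {y ∷ xs} (there x∈) px with P? y
... | yes _ = Product.map₂ there (filterΣ-complete P? x∈ px)
... | no _  = filterΣ-complete P? x∈ px

embeddings-complete : ∀ X G (φ : Embedding X G) → ∃[ φ′ ] φ′ ∈ embeddings X G × proj₁ φ′ ≗ proj₁ φ
embeddings-complete X G (f , f-inj , f-pres) with allFuns-complete (nV X) (nV G) f
... | f′ , f′∈ , f′≗f with filterΣ-complete _ f′∈ (f′-inj , f′-pres)
  where
  f′-inj : Injective f′
  f′-inj u v eq = f-inj u v (trans (sym (f′≗f u)) (trans eq (f′≗f v)))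
  f′-pres : EdgePreserving X G f′
  f′-pres u v uv = subst₂ (λ a b → adj G a b ≡ true) (sym (f′≗f u)) (sym (f′≗f v)) (f-pres u v uv)
... | p , φ′∈ = (f′ , p) , φ′∈ , f′≗f

isoSet-sound : ∀ G X {π} → π ∈ isoSet G X → ∃[ φ ] π ≡ edgeMapOf X G φ
isoSet-sound G X π∈ with ∈-map⁻ (edgeMapOf X G) (∈-deduplicate⁻ _ _ π∈)
... | φ , _ , π≡ = φ , π≡

-- G/X lists each edge map only once, but the element it keeps for the edge map of φ
-- may come from a different vertex map; since edge maps are determined by their keys,
-- it is still the edge map of φ.
edgeMapOf∈isoSet : ∀ X G (φ : Embedding X G) → edgeMapOf X G φ ∈ isoSet G X
edgeMapOf∈isoSet X G φ with embeddings-complete X G φ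
... | φ′ , φ′∈ , φ′≗φ with find (Any.deduplicate⁺ _ sameKey (Any.map (cong (keyOf {G} {X})) (∈-map⁺ (edgeMapOf X G) φ′∈)))
  where
  κ = keyOf {G} {X}
  sameKey : ∀ {π π′} → κ π′ ≡ κ π → κ (edgeMapOf X G φ′) ≡ κ π → κ (edgeMapOf X G φ′) ≡ κ π′
  sameKey π′~π k≡ = trans k≡ (sym π′~π)
... | π , π∈ , keyπ with isoSet-sound G X π∈
... | φ″ , refl = subst (_∈ isoSet G X) φ″≡φ π∈
  where
  φ″≡φ : edgeMapOf X G φ″ ≡ edgeMapOf X G φ
  φ″≡φ = trans (edgeMapOf-keyOf-injective X G φ″ φ′ (sym keyπ)) (edgeMapOf-cong X G φ′ φ φ′≗φ)

isoSet-nonempty⇒embedding : ∀ G X → isoSet G X ≢ [] → Embedding X G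
isoSet-nonempty⇒embedding G X ne with isoSet G X in eq
... | []    = ⊥-elim (ne refl)
... | π ∷ _ = proj₁ (isoSet-sound G X (subst (π ∈_) (sym eq) (here refl)))

agrees-compose : ∀ X S T (g : Embedding S T) (φ : Embedding X S) {A : Set} (ρ : Hom T A) (ψ : Hom X A) →
  Agrees (ρ ∘ edgeImage S T g) ψ (edgeMapOf X S φ) → Agrees ρ ψ (edgeMapOf X T (composeEmbedding X S T g φ))
agrees-compose X S T g φ ρ ψ agrees =
  All.map⁺ (All.map (λ {e} → trans (cong ρ (edgeImage-compose X S T g φ e))) (All.map⁻ agrees))

arrows-mono : ∀ {q} S T → Embedding S T → ∀ {nJ} (X : Fin nJ → Graph) (ψ : ∀ j → Hom (X j) (Fin q)) →
              Arrows S X ψ → Arrows T X ψ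
arrows-mono S T g X ψ arrowsS ρ with arrowsS (ρ ∘ edgeImage S T g)
... | j , π , π∈ , agrees with isoSet-sound S (X j) π∈
... | φ , refl = j , _ , edgeMapOf∈isoSet (X j) T (composeEmbedding (X j) S T g φ) ,
                 agrees-compose (X j) S T g φ ρ (ψ j) agrees

module _ {I : Set} {_<_ : Rel I 0ℓ} where
  open OrderNotions _<_

  IsLeast-cong : ∀ {P Q : I → Set} → (∀ i → P i ⇔ Q i) → ∀ {n} → IsLeast P n → IsLeast Q n
  IsLeast-cong P⇔Q (Pn , minimal) = Equivalence.to (P⇔Q _) Pn , λ i → minimal i ∘ Equivalence.from (P⇔Q i)

  eventually⇔ : ∀ {P : I → Set} → P Respects _≤_ → ∀ n → (∀ t → n ≤ t → P t) ⇔ P n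
  eventually⇔ upward n = mk⇔ (λ always → always n (inj₂ refl)) (λ Pn t n≤t → upward n≤t Pn)

  module _ (sto : IsStrictTotalOrder _≡_ _<_) where
    open IsStrictTotalOrder sto using (compare; irrefl; asym)

    least⇒successor-of-greatest-failure : ∀ {P : I → Set} → P Respects _≤_ → ∀ {R m} →
      IsLeast P R → IsGreatest (¬_ ∘ P) m → IsSuccessor m R
    least⇒successor-of-greatest-failure {P} upward {R} {m} (PR , minimal) (¬Pm , maximal) = m<R , R-next
      where
      m<R : m < R
      m<R with compare m R
      ... | tri< m<R _ _ = m<R
      ... | tri≈ _ m≡R _ = ⊥-elim (¬Pm (subst P (sym m≡R) PR))
      ... | tri> _ _ R<m = ⊥-elim (¬Pm (upward (inj₁ R<m) PR))
      R-next : ∀ i → m < i → R ≤ i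
      R-next i m<i with compare R i
      ... | tri< R<i _ _ = inj₁ R<i
      ... | tri≈ _ R≡i _ = inj₂ R≡i
      ... | tri> _ _ i<R with maximal i (λ Pi → R≰i (minimal i Pi))
        where
        R≰i : ¬ R ≤ i
        R≰i (inj₁ R<i) = asym R<i i<R
        R≰i (inj₂ R≡i) = irrefl (sym R≡i) i<R
      ...   | inj₁ i<m = ⊥-elim (asym i<m m<i)
      ...   | inj₂ i≡m = ⊥-elim (irrefl (sym i≡m) m<i)

theorem3 : (q : ℕ) → IsPrimePower q → (F : FieldOn q) →
    (I : Set) (_<_ : Rel I 0ℓ) → IsStrictTotalOrder _≡_ _<_ → WellFounded _<_ →
    (G : I → Graph) → OrderNotions.Hereditary _<_ G →
    (nJ : ℕ) (X : Fin nJ → Graph) (ψ : (j : Fin nJ) → Hom (X j) (Fin q)) →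
    (R : I) → OrderNotions.IsRamseyNumber _<_ G X ψ R →
    OrderNotions.IsLeast _<_ (λ i → Poly.IsZeroFun F (G i) (Poly.pFam F (G i) X ψ)) R
    × (∀ m → OrderNotions.IsGreatest _<_ (λ i → ¬ Poly.IsZeroFun F (G i) (Poly.pFam F (G i) X ψ)) m →
             OrderNotions.IsSuccessor _<_ m R)
theorem3 zero          _ F = ⊥-elim (¬Fin0 (FieldOn.0# F))
theorem3 (suc zero)    _ F with FieldOn.0# F | FieldOn.1# F | FieldOn.0≢1 F
... | zero | zero | 0≢1 = ⊥-elim (0≢1 refl)
theorem3 (suc (suc k)) _ F I _<_ sto _ G hereditary nJ X ψ R ramsey =
  leastVanishing , λ m → least⇒successor-of-greatest-failure sto vanishes-upward leastVanishing
  where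
  open OrderNotions _<_
  open FiniteField F using (isZeroFun⇔arrows)

  Vanishes : I → Set
  Vanishes i = Poly.IsZeroFun F (G i) (Poly.pFam F (G i) X ψ)

  arrows-upward : (λ i → Arrows (G i) X ψ) Respects _≤_
  arrows-upward (inj₂ refl) = id
  arrows-upward {s} {t} (inj₁ s<t) =
    arrows-mono (G s) (G t) (isoSet-nonempty⇒embedding (G t) (G s) (hereditary t t (inj₂ refl) s s<t t (inj₂ refl))) X ψ

  vanishes⇔arrows : ∀ i → Vanishes i ⇔ Arrows (G i) X ψ
  vanishes⇔arrows i = isZeroFun⇔arrows (G i) X ψ

  vanishes-upward : Vanishes Respects _≤_
  vanishes-upward s≤t = Equivalence.from (vanishes⇔arrows _) ∘ arrows-upward s≤t ∘ Equivalence.to (vanishes⇔arrows _)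

  leastVanishing : IsLeast Vanishes R
  leastVanishing = IsLeast-cong {_<_ = _<_} (λ i → ⇔.trans (eventually⇔ arrows-upward i) (⇔.sym (vanishes⇔arrows i))) ramsey
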